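{- Let $M$ and $N$ be matroids on a finite set $E$ such that $N$ is a cyclic reduction of $M$, and let $F$ be a flat of $M$. Then $F$ is a flat of $N$ with $\mathrm{rank}_N(F)=\mathrm{rank}_M(F)$ if and only if $\mathrm{cyc}_M(F)$ is a cyclic flat of $N$.
   Context: For a flat $F$ of a matroid $M$, $\mathrm{cyc}_M(F)$ denotes the union of all circuits of $M$ contained in $F$ (again a flat). A flat is cyclic if $F=\mathrm{cyc}_M(F)$; $\mathcal{Z}(M)$ denotes the set of cyclic flats of $M$. $N$ is a cyclic reduction of $M$ if $\{\emptyset,\mathrm{cyc}_M(E)\}\subseteq \mathcal{Z}(N)\subseteq \mathcal{Z}(M)$ and $\mathrm{rank}_N(Z)=\mathrm{rank}_M(Z)$ for all $Z\in\mathcal{Z}(N)$. -}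

module Defs where

open import Data.Nat using (ℕ; _≤_; _<_; _+_; _≟_; _<?_)
open import Data.Fin using (Fin)
open import Data.Fin.Subset using (Subset; _∈_; _∉_; _⊆_; _⊂_; _∪_; _∩_; ∣_∣; ⁅_⁆; ⊥; ⊤)
open import Data.Fin.Subset.Properties using (_∈?_; _⊆?_; _⊂?_; anySubset?)
open import Data.Product using (_×_; ∃; _,_)
open import Data.Product.Properties using () 
open import Data.Vec using (tabulate)
open import Relation.Nullary using (Dec; yes; no; ¬_; does)
open import Relation.Nullary.Decidable using (_×-dec_; ¬?)
open import Relation.Binary.PropositionalEquality using (_≡_; _≢_)

record Matroid (n : ℕ) : Set where
  field
    rank        : Subset n → ℕ
    rank-bound  : ∀ X → rank X ≤ ∣ X ∣
    rank-mono   : ∀ {X Y} → X ⊆ Y → rank X ≤ rank Y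
    rank-submod : ∀ X Y → rank (X ∪ Y) + rank (X ∩ Y) ≤ rank X + rank Y
open Matroid public

module _ {n : ℕ} (M : Matroid n) where

  Independent : Subset n → Set
  Independent X = rank M X ≡ ∣ X ∣

  Dependent : Subset n → Set
  Dependent X = rank M X < ∣ X ∣

  Circuit : Subset n → Set
  Circuit C = Dependent C × (∀ Y → Y ⊂ C → Independent Y)

  Flat : Subset n → Set
  Flat F = ∀ e → e ∉ F → rank M F < rank M (F ∪ ⁅ e ⁆)

  private
    allIndep? : ∀ C → Dec (∀ Y → Y ⊂ C → Independent Y)
    allIndep? C with anySubset? (λ Y → (Y ⊂? C) ×-dec ¬? (rank M Y ≟ ∣ Y ∣))
    ... | yes (Y , Y⊂C , ¬ind) = no (λ h → ¬ind (h Y Y⊂C))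
    ... | no ¬ex = yes λ Y Y⊂C → helper Y Y⊂C
      where
      helper : ∀ Y → Y ⊂ C → Independent Y
      helper Y Y⊂C with rank M Y ≟ ∣ Y ∣
      ... | yes eq = eq
      ... | no neq = Data.Empty.⊥-elim (¬ex (Y , Y⊂C , neq))
        where import Data.Empty

  Circuit? : ∀ C → Dec (Circuit C)
  Circuit? C = (rank M C <? ∣ C ∣) ×-dec allIndep? C

  -- cyc_M(F): the union of all circuits of M contained in F
  cyc : Subset n → Subset n
  cyc F = tabulate λ e → does (anySubset? (λ C → Circuit? C ×-dec (C ⊆? F) ×-dec (e ∈? C)))

  Cyclic : Subset n → Set
  Cyclic F = cyc F ≡ F

  CyclicFlat : Subset n → Set
  CyclicFlat Z = Flat Z × Cyclic Z

record CyclicReduction {n : ℕ} (M N : Matroid n) : Set where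
  field
    empty-cyclicFlat : CyclicFlat N ⊥
    cycE-cyclicFlat  : CyclicFlat N (cyc M ⊤)
    cyclicFlats-sub  : ∀ Z → CyclicFlat N Z → CyclicFlat M Z
    rank-agree       : ∀ Z → CyclicFlat N Z → rank N Z ≡ rank M Z

module Submission where

-- Everything rests on one rank identity: the elements of F outside cyc F are
-- exactly the coloops of F, so (cyc-rank-balance)
--   r (cyc F) + |F| ≤ r F + |cyc F|,
-- the reverse inequality holding for any subset (rank-growth).
-- For a cyclic reduction N of M this gives rank_M ≤ rank_N everywhere
-- (compare both with the cyclic flat cyc_N (cl_N X)), and the two directions
-- of the proposition follow by comparing ranks through cyc_M F resp. cyc_N F.

open import Defs
open import Data.Nat using (ℕ; zero; suc; _+_; _≤_; _<_; z≤n; s≤s; s≤s⁻¹; _<?_; _≤?_)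
open import Data.Nat.Properties
open import Data.Fin using (Fin; zero; suc)
import Data.Fin.Properties as Fin
open import Data.Fin.Subset
  using (Subset; _∈_; _∉_; _⊆_; _⊂_; _∪_; _∩_; _─_; _-_; ∣_∣; ⁅_⁆; ⊥; inside; outside)
open import Data.Fin.Subset.Properties
open import Data.Vec using (_∷_; tabulate)
open import Data.Vec.Base using (here; there)
open import Data.Vec.Properties using (lookup∘tabulate; []=⇒lookup; lookup⇒[]=)
open import Data.Product using (_×_; ∃; _,_; proj₁; proj₂)
open import Data.Sum using (_⊎_; inj₁; inj₂)
open import Function using (_∘_)
open import Function.Bundles using (_⇔_; mk⇔)
open import Relation.Nullary using (Dec; yes; no; does; contradiction)
open import Relation.Nullary.Decidable using (dec-true; decidable-stable; _×-dec_; ¬?)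
open import Relation.Binary.PropositionalEquality

-- Finite-set bookkeeping

∣p∪⁅x⁆∣≡1+∣p∣ : ∀ {n} (p : Subset n) {x : Fin n} → x ∉ p → ∣ p ∪ ⁅ x ⁆ ∣ ≡ suc ∣ p ∣
∣p∪⁅x⁆∣≡1+∣p∣ (outside ∷ p) {zero}  _   = cong (suc ∘ ∣_∣) (∪-identityʳ p)
∣p∪⁅x⁆∣≡1+∣p∣ (inside  ∷ p) {zero}  x∉p = contradiction here x∉p
∣p∪⁅x⁆∣≡1+∣p∣ (outside ∷ p) {suc x} x∉p = ∣p∪⁅x⁆∣≡1+∣p∣ p (x∉p ∘ there)
∣p∪⁅x⁆∣≡1+∣p∣ (inside  ∷ p) {suc x} x∉p = cong suc (∣p∪⁅x⁆∣≡1+∣p∣ p (x∉p ∘ there))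

1+∣p-x∣≡∣p∣ : ∀ {n} (p : Subset n) {x : Fin n} → x ∈ p → suc ∣ p - x ∣ ≡ ∣ p ∣
1+∣p-x∣≡∣p∣ (inside  ∷ p) {zero}  here        = cong (suc ∘ ∣_∣) (p─⊥≡p p)
1+∣p-x∣≡∣p∣ (outside ∷ p) {suc x} (there x∈p) = 1+∣p-x∣≡∣p∣ p x∈p
1+∣p-x∣≡∣p∣ (inside  ∷ p) {suc x} (there x∈p) = cong suc (1+∣p-x∣≡∣p∣ p x∈p)

x∈p─q⁻ : ∀ {n} (p q : Subset n) {x : Fin n} → x ∈ p ─ q → x ∈ p × x ∉ q
x∈p─q⁻ (s ∷ p) (outside ∷ q) here        = here , λ ()
x∈p─q⁻ (s ∷ p) (t ∷ q)       (there x∈) with x∈p─q⁻ p q x∈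
... | x∈p , x∉q = there x∈p , x∉q ∘ drop-there

x∈p-y⁻ : ∀ {n} {p : Subset n} {x y : Fin n} → x ∈ p - y → x ∈ p × x ≢ y
x∈p-y⁻ {p = p} {y = y} x∈ with x∈p─q⁻ p ⁅ y ⁆ x∈
... | x∈p , x∉⁅y⁆ = x∈p , x∉⁅y⁆⇒x≢y x∉⁅y⁆

x∈p∪⁅x⁆ : ∀ {n} (p : Subset n) {x : Fin n} → x ∈ p ∪ ⁅ x ⁆
x∈p∪⁅x⁆ p {x} = q⊆p∪q p ⁅ x ⁆ (x∈⁅x⁆ x)

∪⁅⁆-⊆ : ∀ {n} {p q : Subset n} {x : Fin n} → p ⊆ q → x ∈ q → p ∪ ⁅ x ⁆ ⊆ q
∪⁅⁆-⊆ {p = p} {x = x} p⊆q x∈q y∈ with x∈p∪q⁻ p ⁅ x ⁆ y∈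
... | inj₁ y∈p   = p⊆q y∈p
... | inj₂ y∈⁅x⁆ = subst (_∈ _) (sym (x∈⁅y⁆⇒x≡y x y∈⁅x⁆)) x∈q

∪⁅⁆-mono : ∀ {n} {p q : Subset n} {x : Fin n} → p ⊆ q → p ∪ ⁅ x ⁆ ⊆ q ∪ ⁅ x ⁆
∪⁅⁆-mono {q = q} p⊆q = ∪⁅⁆-⊆ (⊆-trans p⊆q (p⊆p∪q _)) (x∈p∪⁅x⁆ q)

⊆-∉⇒⊆- : ∀ {n} {p q : Subset n} {x : Fin n} → p ⊆ q → x ∉ p → p ⊆ q - x
⊆-∉⇒⊆- p⊆q x∉p y∈p = x∈p∧x≢y⇒x∈p-y (p⊆q y∈p) λ { refl → x∉p y∈p }

⊆-∪⁅⁆-∉ : ∀ {n} {p q : Subset n} {x : Fin n} → p ⊆ q ∪ ⁅ x ⁆ → x ∉ p → p ⊆ q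
⊆-∪⁅⁆-∉ {q = q} {x} p⊆ x∉p {y} y∈p with x∈p∪q⁻ q ⁅ x ⁆ (p⊆ y∈p)
... | inj₁ y∈q   = y∈q
... | inj₂ y∈⁅x⁆ = contradiction (subst (_∈ _) (x∈⁅y⁆⇒x≡y x y∈⁅x⁆) y∈p) x∉p

p⊆p-x∪⁅x⁆ : ∀ {n} (p : Subset n) (x : Fin n) → p ⊆ (p - x) ∪ ⁅ x ⁆
p⊆p-x∪⁅x⁆ p x {y} y∈p with y Fin.≟ x
... | yes refl = x∈p∪⁅x⁆ (p - x)
... | no  y≢x  = p⊆p∪q ⁅ x ⁆ (x∈p∧x≢y⇒x∈p-y y∈p y≢x)

⊆⇒≡⊎⊂ : ∀ {n} {H F : Subset n} → H ⊆ F → H ≡ F ⊎ H ⊂ F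
⊆⇒≡⊎⊂ {H = H} {F} H⊆F with Fin.any? (λ e → (e ∈? F) ×-dec ¬? (e ∈? H))
... | yes missing = inj₂ (H⊆F , missing)
... | no  none    = inj₁ (⊆-antisym H⊆F λ {e} e∈F →
                      decidable-stable (e ∈? H) λ e∉H → none (e , e∈F , e∉H))

module _ {n : ℕ} {P : Fin n → Set} (P? : ∀ x → Dec (P x)) where

  ∈-tabulate⁻ : ∀ {x} → x ∈ tabulate (λ e → does (P? e)) → P x
  ∈-tabulate⁻ {x} x∈ with P? x | trans (sym (lookup∘tabulate _ x)) ([]=⇒lookup x∈)
  ... | yes px | _  = px
  ... | no  _  | ()

  ∈-tabulate⁺ : ∀ {x} → P x → x ∈ tabulate (λ e → does (P? e))
  ∈-tabulate⁺ {x} px = lookup⇒[]= x _ (trans (lookup∘tabulate _ x) (dec-true (P? x) px))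

grow : ∀ {n} (P : Subset n → Set) {G F : Subset n} → G ⊆ F → P G →
       (∀ {H e} → G ⊆ H → H ⊆ F → e ∈ F → e ∉ H → P H → P (H ∪ ⁅ e ⁆)) → P F
grow P {G} {F} G⊆F PG step = go ∣ F ∣ ⊆-refl G⊆F (m≤m+n ∣ F ∣ ∣ G ∣) PG
  where
  -- the fuel k bounds the number of elements of F still missing from H
  go : ∀ k {H} → G ⊆ H → H ⊆ F → ∣ F ∣ ≤ k + ∣ H ∣ → P H → P F
  go k G⊆H H⊆F bound PH with ⊆⇒≡⊎⊂ H⊆F
  go k       _ _ _ PH | inj₁ refl = PH
  go zero    _ _ bound _ | inj₂ H⊂F = contradiction bound (<⇒≱ (p⊂q⇒∣p∣<∣q∣ H⊂F))
  go (suc k) {H} G⊆H H⊆F bound PH | inj₂ (_ , e , e∈F , e∉H) =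
    go k (⊆-trans G⊆H (p⊆p∪q _)) (∪⁅⁆-⊆ H⊆F e∈F) bound′ (step G⊆H H⊆F e∈F e∉H PH)
    where
    bound′ : ∣ F ∣ ≤ k + ∣ H ∪ ⁅ e ⁆ ∣
    bound′ = subst (∣ F ∣ ≤_) (trans (sym (+-suc k ∣ H ∣)) (cong (k +_) (sym (∣p∪⁅x⁆∣≡1+∣p∣ H e∉H)))) bound

module Rank {n : ℕ} (M : Matroid n) where

  r : Subset n → ℕ
  r = rank M

  mono : ∀ {X Y} → X ⊆ Y → r X ≤ r Y
  mono = rank-mono M

  r-∪⁅⁆ : ∀ X e → r (X ∪ ⁅ e ⁆) ≤ suc (r X)
  r-∪⁅⁆ X e = begin
    r (X ∪ ⁅ e ⁆)                  ≤⟨ m≤m+n _ _ ⟩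
    r (X ∪ ⁅ e ⁆) + r (X ∩ ⁅ e ⁆)  ≤⟨ rank-submod M X ⁅ e ⁆ ⟩
    r X + r ⁅ e ⁆                  ≤⟨ +-monoʳ-≤ (r X) (subst (r ⁅ e ⁆ ≤_) (∣⁅x⁆∣≡1 e) (rank-bound M ⁅ e ⁆)) ⟩
    r X + 1                        ≡⟨ +-comm (r X) 1 ⟩
    suc (r X)                      ∎
    where open ≤-Reasoning

  -- Submodularity as diminishing returns: an element raising the rank of Y
  -- raises the rank of every subset of Y.
  increment-antitone : ∀ {X Y e} → X ⊆ Y → r Y < r (Y ∪ ⁅ e ⁆) → r X < r (X ∪ ⁅ e ⁆)
  increment-antitone {X} {Y} {e} X⊆Y raisesY = ≰⇒> λ Xe≤X →
    <⇒≱ raisesY (+-cancelʳ-≤ (r X) _ _ (begin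
      r (Y ∪ ⁅ e ⁆) + r X                        ≤⟨ +-mono-≤ (mono Ye⊆) (mono X⊆) ⟩
      r (Y ∪ (X ∪ ⁅ e ⁆)) + r (Y ∩ (X ∪ ⁅ e ⁆))  ≤⟨ rank-submod M Y (X ∪ ⁅ e ⁆) ⟩
      r Y + r (X ∪ ⁅ e ⁆)                        ≤⟨ +-monoʳ-≤ (r Y) Xe≤X ⟩
      r Y + r X                                  ∎))
    where
    open ≤-Reasoning
    Ye⊆ : Y ∪ ⁅ e ⁆ ⊆ Y ∪ (X ∪ ⁅ e ⁆)
    Ye⊆ = ∪⁅⁆-⊆ (p⊆p∪q _) (q⊆p∪q Y _ (x∈p∪⁅x⁆ X))
    X⊆ : X ⊆ Y ∩ (X ∪ ⁅ e ⁆)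
    X⊆ x∈X = x∈p∩q⁺ (X⊆Y x∈X , p⊆p∪q _ x∈X)

  spanned-upward : ∀ {X Y e} → X ⊆ Y → r (X ∪ ⁅ e ⁆) ≤ r X → r (Y ∪ ⁅ e ⁆) ≤ r Y
  spanned-upward X⊆Y spannedX = ≮⇒≥ λ raisesY → <⇒≱ (increment-antitone X⊆Y raisesY) spannedX

  coloop-raises : ∀ {F X e} → r (F - e) < r F → X ⊆ F - e → r X < r (X ∪ ⁅ e ⁆)
  coloop-raises {F} {X} {e} coloop X⊆ =
    increment-antitone X⊆ (<-≤-trans coloop (mono (p⊆p-x∪⁅x⁆ F e)))

  rank-growth : ∀ {G F} → G ⊆ F → r F + ∣ G ∣ ≤ r G + ∣ F ∣
  rank-growth {G} {F} G⊆F = grow (λ H → r H + ∣ G ∣ ≤ r G + ∣ H ∣) G⊆F ≤-refl step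
    where
    step : ∀ {H e} → G ⊆ H → H ⊆ F → e ∈ F → e ∉ H →
           r H + ∣ G ∣ ≤ r G + ∣ H ∣ → r (H ∪ ⁅ e ⁆) + ∣ G ∣ ≤ r G + ∣ H ∪ ⁅ e ⁆ ∣
    step {H} {e} _ _ _ e∉H ih = begin
      r (H ∪ ⁅ e ⁆) + ∣ G ∣  ≤⟨ +-monoˡ-≤ ∣ G ∣ (r-∪⁅⁆ H e) ⟩
      suc (r H + ∣ G ∣)      ≤⟨ s≤s ih ⟩
      suc (r G + ∣ H ∣)      ≡⟨ +-suc (r G) ∣ H ∣ ⟨
      r G + suc ∣ H ∣        ≡⟨ cong (r G +_) (∣p∪⁅x⁆∣≡1+∣p∣ H e∉H) ⟨
      r G + ∣ H ∪ ⁅ e ⁆ ∣    ∎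
      where open ≤-Reasoning

  coloop-growth : ∀ {G F} → G ⊆ F → (∀ {e} → e ∈ F → e ∉ G → r (F - e) < r F) →
                  r G + ∣ F ∣ ≤ r F + ∣ G ∣
  coloop-growth {G} {F} G⊆F coloops = grow (λ H → r G + ∣ H ∣ ≤ r H + ∣ G ∣) G⊆F ≤-refl step
    where
    step : ∀ {H e} → G ⊆ H → H ⊆ F → e ∈ F → e ∉ H →
           r G + ∣ H ∣ ≤ r H + ∣ G ∣ → r G + ∣ H ∪ ⁅ e ⁆ ∣ ≤ r (H ∪ ⁅ e ⁆) + ∣ G ∣
    step {H} {e} G⊆H H⊆F e∈F e∉H ih = begin
      r G + ∣ H ∪ ⁅ e ⁆ ∣    ≡⟨ cong (r G +_) (∣p∪⁅x⁆∣≡1+∣p∣ H e∉H) ⟩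
      r G + suc ∣ H ∣        ≡⟨ +-suc (r G) ∣ H ∣ ⟩
      suc (r G + ∣ H ∣)      ≤⟨ s≤s ih ⟩
      suc (r H + ∣ G ∣)      ≤⟨ +-monoˡ-≤ ∣ G ∣ raises ⟩
      r (H ∪ ⁅ e ⁆) + ∣ G ∣  ∎
      where
      open ≤-Reasoning
      raises : r H < r (H ∪ ⁅ e ⁆)
      raises = coloop-raises (coloops e∈F (e∉H ∘ G⊆H)) (⊆-∉⇒⊆- H⊆F e∉H)

  independent-⊆ : ∀ {I C} → Independent M I → C ⊆ I → Independent M C
  independent-⊆ {I} {C} indI C⊆I = ≤-antisym (rank-bound M C) (+-cancelˡ-≤ ∣ I ∣ _ _ (begin
    ∣ I ∣ + ∣ C ∣  ≡⟨ cong (_+ ∣ C ∣) indI ⟨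
    r I + ∣ C ∣    ≤⟨ rank-growth C⊆I ⟩
    r C + ∣ I ∣    ≡⟨ +-comm (r C) ∣ I ∣ ⟩
    ∣ I ∣ + r C    ∎))
    where open ≤-Reasoning

  circuit-⊆ : ∀ {D} → Dependent M D → ∃ λ C → Circuit M C × C ⊆ D
  circuit-⊆ {D} = go (suc ∣ D ∣) ≤-refl
    where
    go : ∀ k {D} → ∣ D ∣ < k → Dependent M D → ∃ λ C → Circuit M C × C ⊆ D
    go zero () _
    go (suc k) {D} size depD with anySubset? (λ Y → (Y ⊂? D) ×-dec (r Y <? ∣ Y ∣))
    ... | no none = D , (depD , minimal) , ⊆-refl
      where
      minimal : ∀ Y → Y ⊂ D → Independent M Y
      minimal Y Y⊂D = ≤-antisym (rank-bound M Y) (≮⇒≥ λ depY → none (Y , Y⊂D , depY))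
    ... | yes (Y , Y⊂D , depY) with go k (<-≤-trans (p⊂q⇒∣p∣<∣q∣ Y⊂D) (s≤s⁻¹ size)) depY
    ...   | C , circuit , C⊆Y = C , circuit , ⊆-trans C⊆Y (proj₁ Y⊂D)

  OnCircuitIn : Subset n → Fin n → Set
  OnCircuitIn F e = ∃ λ C → Circuit M C × C ⊆ F × e ∈ C

  private
    onCircuitIn? : ∀ F e → Dec (OnCircuitIn F e)
    onCircuitIn? F e = anySubset? (λ C → Circuit? M C ×-dec (C ⊆? F) ×-dec (e ∈? C))

  cyc⁻ : ∀ {F e} → e ∈ cyc M F → OnCircuitIn F e
  cyc⁻ {F} = ∈-tabulate⁻ (onCircuitIn? F)

  cyc⁺ : ∀ {F e C} → Circuit M C → C ⊆ F → e ∈ C → e ∈ cyc M F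
  cyc⁺ {F} circuit C⊆F e∈C = ∈-tabulate⁺ (onCircuitIn? F) (_ , circuit , C⊆F , e∈C)

  cyc-⊆ : ∀ {F} → cyc M F ⊆ F
  cyc-⊆ e∈ with cyc⁻ e∈
  ... | C , _ , C⊆F , e∈C = C⊆F e∈C

  cyc-mono : ∀ {F G} → F ⊆ G → cyc M F ⊆ cyc M G
  cyc-mono F⊆G e∈ with cyc⁻ e∈
  ... | C , circuit , C⊆F , e∈C = cyc⁺ circuit (⊆-trans C⊆F F⊆G) e∈C

  -- Every circuit inside F lies inside cyc F, so cyc F is cyclic.
  cyc-cyclic : ∀ F → Cyclic M (cyc M F)
  cyc-cyclic F = ⊆-antisym cyc-⊆ cyc⊆cyc-cyc
    where
    cyc⊆cyc-cyc : cyc M F ⊆ cyc M (cyc M F)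
    cyc⊆cyc-cyc e∈ with cyc⁻ e∈
    ... | C , circuit , C⊆F , e∈C = cyc⁺ circuit (cyc⁺ circuit C⊆F) e∈C

  cyc⇒not-coloop : ∀ {F e} → e ∈ cyc M F → r F ≤ r (F - e)
  cyc⇒not-coloop {F} {e} e∈ with cyc⁻ e∈
  ... | C , (depC , minimal) , C⊆F , e∈C = begin
    r F                     ≤⟨ mono (p⊆p-x∪⁅x⁆ F e) ⟩
    r ((F - e) ∪ ⁅ e ⁆)     ≤⟨ spanned-upward C-e⊆F-e spanned ⟩
    r (F - e)               ∎
    where
    open ≤-Reasoning
    C-e⊆F-e : C - e ⊆ F - e
    C-e⊆F-e x∈ with x∈p-y⁻ x∈
    ... | x∈C , x≢e = x∈p∧x≢y⇒x∈p-y (C⊆F x∈C) x≢e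
    -- C - e is independent while C is dependent, so e is spanned by C - e
    spanned : r ((C - e) ∪ ⁅ e ⁆) ≤ r (C - e)
    spanned = begin
      r ((C - e) ∪ ⁅ e ⁆)  ≤⟨ mono (∪⁅⁆-⊆ (p─q⊆p C _) e∈C) ⟩
      r C                  ≤⟨ s≤s⁻¹ (subst (suc (r C) ≤_) (sym (1+∣p-x∣≡∣p∣ C e∈C)) depC) ⟩
      ∣ C - e ∣            ≡⟨ minimal (C - e) (x∈p⇒p-x⊂p e∈C) ⟨
      r (C - e)            ∎

  Basis : Subset n → Set
  Basis X = ∃ λ I → I ⊆ X × Independent M I × r X ≡ ∣ I ∣

  basis : ∀ X → Basis X
  basis X = grow Basis (⊆-min X) (⊥ , ⊆-refl , r⊥≡∣⊥∣ , r⊥≡∣⊥∣) step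
    where
    r⊥≡∣⊥∣ : r ⊥ ≡ ∣ ⊥ {n} ∣
    r⊥≡∣⊥∣ = ≤-antisym (rank-bound M ⊥) (subst (_≤ r ⊥) (sym (∣⊥∣≡0 n)) z≤n)
    step : ∀ {H e} → ⊥ ⊆ H → H ⊆ X → e ∈ X → e ∉ H → Basis H → Basis (H ∪ ⁅ e ⁆)
    step {H} {e} _ _ _ e∉H (I , I⊆H , indI , rH≡∣I∣) with r H <? r (H ∪ ⁅ e ⁆)
    ... | no ¬raises = I , ⊆-trans I⊆H (p⊆p∪q _) , indI ,
                       trans (≤-antisym (≮⇒≥ ¬raises) (mono (p⊆p∪q _))) rH≡∣I∣
    ... | yes raises = I ∪ ⁅ e ⁆ , ∪⁅⁆-mono I⊆H , indIe , rHe≡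
      where
      open ≤-Reasoning
      ∣Ie∣ : ∣ I ∪ ⁅ e ⁆ ∣ ≡ suc ∣ I ∣
      ∣Ie∣ = ∣p∪⁅x⁆∣≡1+∣p∣ I (e∉H ∘ I⊆H)
      indIe : Independent M (I ∪ ⁅ e ⁆)
      indIe = ≤-antisym (rank-bound M _) (begin
        ∣ I ∪ ⁅ e ⁆ ∣   ≡⟨ trans ∣Ie∣ (cong suc (sym indI)) ⟩
        suc (r I)       ≤⟨ increment-antitone I⊆H raises ⟩
        r (I ∪ ⁅ e ⁆)   ∎)
      rHe≡ : r (H ∪ ⁅ e ⁆) ≡ ∣ I ∪ ⁅ e ⁆ ∣
      rHe≡ = ≤-antisym
        (subst (r (H ∪ ⁅ e ⁆) ≤_) (trans (cong suc rH≡∣I∣) (sym ∣Ie∣)) (r-∪⁅⁆ H e))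
        (subst (_≤ r (H ∪ ⁅ e ⁆)) (trans (cong suc rH≡∣I∣) (sym ∣Ie∣)) raises)

  -- Conversely, a non-coloop e of F lies on a circuit inside F: a basis I of
  -- F - e still spans e, so I ∪ {e} is dependent and its circuits contain e.
  not-coloop⇒cyc : ∀ {F e} → e ∈ F → r F ≤ r (F - e) → e ∈ cyc M F
  not-coloop⇒cyc {F} {e} e∈F spanned with basis (F - e)
  ... | I , I⊆F-e , indI , rF-e≡∣I∣ with circuit-⊆ depIe
    where
    e∉I : e ∉ I
    e∉I e∈I = proj₂ (x∈p-y⁻ (I⊆F-e e∈I)) refl
    depIe : Dependent M (I ∪ ⁅ e ⁆)
    depIe = begin-strict
      r (I ∪ ⁅ e ⁆)   ≤⟨ mono (∪⁅⁆-⊆ (proj₁ ∘ x∈p-y⁻ ∘ I⊆F-e) e∈F) ⟩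
      r F             ≤⟨ spanned ⟩
      r (F - e)       ≡⟨ rF-e≡∣I∣ ⟩
      ∣ I ∣           <⟨ n<1+n ∣ I ∣ ⟩
      suc ∣ I ∣       ≡⟨ ∣p∪⁅x⁆∣≡1+∣p∣ I e∉I ⟨
      ∣ I ∪ ⁅ e ⁆ ∣   ∎
      where open ≤-Reasoning
  ... | C , circuit , C⊆Ie = cyc⁺ circuit C⊆F e∈C
    where
    C⊆F : C ⊆ F
    C⊆F = ⊆-trans C⊆Ie (∪⁅⁆-⊆ (proj₁ ∘ x∈p-y⁻ ∘ I⊆F-e) e∈F)
    -- a circuit avoiding e would be a dependent subset of the independent I
    e∈C : e ∈ C
    e∈C = decidable-stable (e ∈? C) λ e∉C →
      <⇒≢ (proj₁ circuit) (independent-⊆ indI (⊆-∪⁅⁆-∉ C⊆Ie e∉C))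

  coloop : ∀ {F e} → e ∈ F → e ∉ cyc M F → r (F - e) < r F
  coloop e∈F e∉cyc = ≰⇒> (e∉cyc ∘ not-coloop⇒cyc e∈F)

  cyc-rank-balance : ∀ F → r (cyc M F) + ∣ F ∣ ≤ r F + ∣ cyc M F ∣
  cyc-rank-balance F = coloop-growth cyc-⊆ coloop

  -- The cyclic part of a flat is a cyclic flat: an element outside F is
  -- not spanned by F, one in F ∖ cyc F is a coloop of F, and in both cases
  -- increment-antitone transfers this to the subset cyc F.
  cyc-cyclicFlat : ∀ {F} → Flat M F → CyclicFlat M (cyc M F)
  cyc-cyclicFlat {F} flatF = flat , cyc-cyclic F
    where
    flat : Flat M (cyc M F)
    flat e e∉cyc with e ∈? F
    ... | no  e∉F = increment-antitone cyc-⊆ (flatF e e∉F)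
    ... | yes e∈F = coloop-raises (coloop e∈F e∉cyc) (⊆-∉⇒⊆- cyc-⊆ e∉cyc)

  cl : Subset n → Subset n
  cl X = tabulate (λ e → does (r (X ∪ ⁅ e ⁆) ≤? r X))

  cl⁻ : ∀ {X e} → e ∈ cl X → r (X ∪ ⁅ e ⁆) ≤ r X
  cl⁻ {X} = ∈-tabulate⁻ (λ e → r (X ∪ ⁅ e ⁆) ≤? r X)

  cl⁺ : ∀ {X e} → r (X ∪ ⁅ e ⁆) ≤ r X → e ∈ cl X
  cl⁺ {X} = ∈-tabulate⁺ (λ e → r (X ∪ ⁅ e ⁆) ≤? r X)

  X⊆cl : ∀ {X} → X ⊆ cl X
  X⊆cl {X} x∈X = cl⁺ (mono (∪⁅⁆-⊆ ⊆-refl x∈X))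

  -- Adding spanned elements one at a time never raises the rank.
  cl-rank : ∀ X → r (cl X) ≡ r X
  cl-rank X = ≤-antisym (grow (λ H → r H ≤ r X) X⊆cl ≤-refl step) (mono X⊆cl)
    where
    step : ∀ {H e} → X ⊆ H → H ⊆ cl X → e ∈ cl X → e ∉ H → r H ≤ r X → r (H ∪ ⁅ e ⁆) ≤ r X
    step X⊆H _ e∈cl _ rH≤rX = ≤-trans (spanned-upward X⊆H (cl⁻ e∈cl)) rH≤rX

  cl-flat : ∀ X → Flat M (cl X)
  cl-flat X e e∉cl = ≰⇒> λ spanned → e∉cl (cl⁺ (begin
    r (X ∪ ⁅ e ⁆)       ≤⟨ mono (∪⁅⁆-mono X⊆cl) ⟩
    r (cl X ∪ ⁅ e ⁆)    ≤⟨ spanned ⟩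
    r (cl X)            ≡⟨ cl-rank X ⟩
    r X                 ∎))
    where open ≤-Reasoning

module Reduction {n : ℕ} {M N : Matroid n} (red : CyclicReduction M N) where

  open CyclicReduction red
  private
    module RM = Rank M
    module RN = Rank N

  -- rank_M ≤ rank_N: with W = cl_N X and its cyclic part Z, which is a cyclic
  -- flat of N, the rank of W grows from Z at most as fast in M as in N.
  rank-below : ∀ X → rank M X ≤ rank N X
  rank-below X = begin
    rank M X     ≤⟨ RM.mono RN.X⊆cl ⟩
    rank M W     ≤⟨ +-cancelʳ-≤ ∣ Z ∣ _ _ growth ⟩
    rank N W     ≡⟨ RN.cl-rank X ⟩
    rank N X     ∎
    where
    open ≤-Reasoning
    W = RN.cl X
    Z = cyc N W
    growth : rank M W + ∣ Z ∣ ≤ rank N W + ∣ Z ∣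
    growth = begin
      rank M W + ∣ Z ∣   ≤⟨ RM.rank-growth RN.cyc-⊆ ⟩
      rank M Z + ∣ W ∣   ≡⟨ cong (_+ ∣ W ∣) (rank-agree Z (RN.cyc-cyclicFlat (RN.cl-flat X))) ⟨
      rank N Z + ∣ W ∣   ≤⟨ RN.cyc-rank-balance W ⟩
      rank N W + ∣ Z ∣   ∎

  rank-above : ∀ {F} → CyclicFlat N (cyc M F) → rank N F ≤ rank M F
  rank-above {F} cfZ = +-cancelʳ-≤ ∣ Z ∣ _ _ (begin
    rank N F + ∣ Z ∣    ≤⟨ RN.rank-growth RM.cyc-⊆ ⟩
    rank N Z + ∣ F ∣    ≡⟨ cong (_+ ∣ F ∣) (rank-agree Z cfZ) ⟩
    rank M Z + ∣ F ∣    ≤⟨ RM.cyc-rank-balance F ⟩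
    rank M F + ∣ Z ∣    ∎)
    where
    open ≤-Reasoning
    Z = cyc M F

  flat-transfer : ∀ {F} → Flat M F → rank N F ≡ rank M F → Flat N F
  flat-transfer {F} flatF r≡ e e∉F = begin-strict
    rank N F            ≡⟨ r≡ ⟩
    rank M F            <⟨ flatF e e∉F ⟩
    rank M (F ∪ ⁅ e ⁆)  ≤⟨ rank-below (F ∪ ⁅ e ⁆) ⟩
    rank N (F ∪ ⁅ e ⁆)  ∎
    where open ≤-Reasoning

  -- For a flat F of N, cyc_N F is a cyclic flat of N, hence cyclic in M,
  -- and lies inside cyc_M F.
  cycN⊆cycM : ∀ {F} → Flat N F → cyc N F ⊆ cyc M F
  cycN⊆cycM {F} flatF x∈ =
    RM.cyc-mono RN.cyc-⊆ (subst (_ ∈_) (sym (proj₂ (cyclicFlats-sub _ (RN.cyc-cyclicFlat flatF)))) x∈)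

  -- If moreover the ranks of F agree, an element x of cyc_M F outside cyc_N F
  -- would be a non-coloop of F in M but a coloop in N.
  cycM⊆cycN : ∀ {F} → Flat N F → rank N F ≡ rank M F → cyc M F ⊆ cyc N F
  cycM⊆cycN {F} flatF r≡ {x} x∈ = decidable-stable (x ∈? Z) λ x∉Z →
    <-irrefl refl (begin-strict
      rank M Z + ∣ F - x ∣  <⟨ +-monoʳ-< (rank M Z) (x∈p⇒∣p-x∣<∣p∣ (RM.cyc-⊆ x∈)) ⟩
      rank M Z + ∣ F ∣      ≡⟨ cong (_+ ∣ F ∣) (rank-agree Z cfZ) ⟨
      rank N Z + ∣ F ∣      ≤⟨ RN.cyc-rank-balance F ⟩
      rank N F + ∣ Z ∣      ≡⟨ cong (_+ ∣ Z ∣) r≡ ⟩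
      rank M F + ∣ Z ∣      ≤⟨ +-monoˡ-≤ ∣ Z ∣ (RM.cyc⇒not-coloop x∈) ⟩
      rank M (F - x) + ∣ Z ∣ ≤⟨ RM.rank-growth (⊆-∉⇒⊆- RN.cyc-⊆ x∉Z) ⟩
      rank M Z + ∣ F - x ∣  ∎)
    where
    open ≤-Reasoning
    Z = cyc N F
    cfZ : CyclicFlat N Z
    cfZ = RN.cyc-cyclicFlat flatF

proposition3p6 : ∀ {n : ℕ} (M N : Matroid n) → CyclicReduction M N →
    ∀ (F : Subset n) → Flat M F →
    ((Flat N F × rank N F ≡ rank M F) ⇔ CyclicFlat N (cyc M F))
proposition3p6 M N red F flatM = mk⇔ to from
  where
  open Reduction red
  to : Flat N F × rank N F ≡ rank M F → CyclicFlat N (cyc M F)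
  to (flatN , r≡) = subst (CyclicFlat N) (⊆-antisym (cycN⊆cycM flatN) (cycM⊆cycN flatN r≡))
                      (Rank.cyc-cyclicFlat N flatN)
  from : CyclicFlat N (cyc M F) → Flat N F × rank N F ≡ rank M F
  from cfZ = flat-transfer flatM r≡ , r≡
    where
    r≡ : rank N F ≡ rank M F
    r≡ = ≤-antisym (rank-above cfZ) (rank-below F)
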